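{- There are exactly $240$ special Sudoku grids over $\mathbb{Z}_5$. Moreover, there is a special Sudoku grid $S_0$ over $\mathbb{Z}_5$ such that every special Sudoku grid over $\mathbb{Z}_5$ is equivalent to $S_0$ up to relabeling and reflection, i.e. is of the form $\sigma\circ S_0$ or $\sigma\circ s(S_0)$ for some permutation $\sigma$ of $\{1,\dots,5\}$ applied entrywise.
   Context: $\mathbb{Z}_5$ is the ring of integers modulo 5, with Lee weight $\mathrm{wt}_L(u_1,u_2)=\sum_i\min\{u_i,5-u_i\}$ (entries in $\{0,\dots,4\}$) and Lee distance $d_L(\mathbf{u},\mathbf{v})=\mathrm{wt}_L(\mathbf{u}-\mathbf{v})$. A $(2,5,3)$ perfect code over $\mathbb{Z}_5$ is a subset $\mathcal{C}\subseteq\mathbb{Z}_5^2$ of size $5$ with minimum Lee distance $3$ such that the Lee balls $\mathcal{B}_1(\mathbf{c})$ of radius $1$, $\mathbf{c}\in\mathcal{C}$, partition $\mathbb{Z}_5^2$. For $\mathcal{C}=\{\mathbf{c}_1,\dots,\mathbf{c}_5\}$ the palette grid $\mathcal{I}_\mathcal{C}$ is the $5\times5$ array (rows and columns indexed by $0,\dots,4$) with entry $i$ at each $(x,y)\in\mathcal{B}_1(\mathbf{c}_i)$. Two $5\times5$ arrays over $\{1,\dots,5\}$ are orthogonal if the ordered pairs of corresponding entries are pairwise distinct. A perfect Sudoku grid with respect to $\mathcal{C}$ is a $5\times5$ Latin square over $\{1,\dots,5\}$ orthogonal to $\mathcal{I}_\mathcal{C}$. A special Sudoku grid over $\mathbb{Z}_5$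 is a $5\times5$ array that is a perfect Sudoku grid with respect to every $(2,5,3)$ perfect code over $\mathbb{Z}_5$. The reflection is $(s(A))_{i,j}=A_{i,4-j}$. -}

module Defs where

open import Data.Nat using (ℕ; _≤_; _⊓_; _∸_; _+_; _≤ᵇ_)
open import Data.Nat.DivMod using (_mod_)
open import Data.Fin using (Fin; toℕ; zero; suc)
open import Data.Bool using (Bool; if_then_else_)
open import Data.Product using (_×_; _,_; ∃)
open import Data.Vec using (Vec; lookup; map; reverse)
open import Data.Fin.Permutation using (Permutation′; _⟨$⟩ʳ_)
open import Relation.Binary.PropositionalEquality using (_≡_; _≢_)

Z5 : Set
Z5 = Fin 5

Z5² : Set
Z5² = Z5 × Z5

_-₅_ : Z5 → Z5 → Z5
a -₅ b = (toℕ a + (5 ∸ toℕ b)) mod 5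

leeWt₁ : Z5 → ℕ
leeWt₁ u = toℕ u ⊓ (5 ∸ toℕ u)

leeWt : Z5² → ℕ
leeWt (u₁ , u₂) = leeWt₁ u₁ + leeWt₁ u₂

leeDist : Z5² → Z5² → ℕ
leeDist (u₁ , u₂) (v₁ , v₂) = leeWt (u₁ -₅ v₁ , u₂ -₅ v₂)

InBall₁ : Z5² → Z5² → Set
InBall₁ c p = leeDist p c ≤ 1

-- A code with 5 listed codewords c₀,…,c₄ (the ordering only labels the palette colours)
Code : Set
Code = Fin 5 → Z5²

IsPerfectCode : Code → Set
IsPerfectCode c =
  (∀ i j → c i ≡ c j → i ≡ j)
  × (∀ i j → i ≢ j → 3 ≤ leeDist (c i) (c j))
  × (∀ p → ∃ λ i → InBall₁ (c i) p)
  × (∀ i j p → InBall₁ (c i) p → InBall₁ (c j) p → i ≡ j)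

-- 5×5 arrays over a 5-element symbol set {1,…,5}, represented by Fin 5
Grid : Set
Grid = Vec (Vec (Fin 5) 5) 5

entry : Grid → Fin 5 → Fin 5 → Fin 5
entry A i j = lookup (lookup A i) j

firstIdx : (Fin 5 → Bool) → Fin 5
firstIdx t =
  if t zero then zero else
  if t (suc zero) then suc zero else
  if t (suc (suc zero)) then suc (suc zero) else
  if t (suc (suc (suc zero))) then suc (suc (suc zero)) else
  if t (suc (suc (suc (suc zero)))) then suc (suc (suc (suc zero))) else zero

palette : Code → Fin 5 → Fin 5 → Fin 5
palette c x y = firstIdx (λ i → leeDist (x , y) (c i) ≤ᵇ 1)

Orthogonal : (Fin 5 → Fin 5 → Fin 5) → (Fin 5 → Fin 5 → Fin 5) → Set
Orthogonal A B = ∀ i j k l → A i j ≡ A k l → B i j ≡ B k l → (i ≡ k × j ≡ l)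

IsLatin : Grid → Set
IsLatin A =
  (∀ i j l → entry A i j ≡ entry A i l → j ≡ l)
  × (∀ j i k → entry A i j ≡ entry A k j → i ≡ k)

PerfectSudoku : Code → Grid → Set
PerfectSudoku c A = IsLatin A × Orthogonal (entry A) (palette c)

Special : Grid → Set
Special A = ∀ (c : Code) → IsPerfectCode c → PerfectSudoku c A

reflect : Grid → Grid
reflect A = map reverse A

relabel : Permutation′ 5 → Grid → Grid
relabel σ A = map (map (σ ⟨$⟩ʳ_)) A

module Submission where

open import Defs
open import Data.Nat using (ℕ)
open import Data.List using (List; length)
open import Data.List.Membership.Propositional using (_∈_)
open import Data.List.Relation.Unary.Unique.Propositional using (Unique)
open import Data.Product using (_×_; Σ; ∃)
open import Data.Sum using (_⊎_)
open import Data.Fin.Permutation using (Permutation′)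
open import Function.Bundles using (_⇔_)
open import Relation.Binary.PropositionalEquality using (_≡_)

open import Data.Bool using (Bool; true; false; T)
open import Data.Bool.Properties using (T-≡)
open import Data.Empty using (⊥-elim)
open import Data.Fin using (Fin; toℕ)
open import Data.Fin.Patterns using (0F; 1F; 2F; 3F; 4F)
open import Data.Fin.Permutation using (_⟨$⟩ʳ_; id; insert)
open import Data.Fin.Properties using (_≟_; all?; any?)
open import Data.List
  using ([]; _∷_; _++_; map; concatMap; filter; allFin; cartesianProduct; _ʳ++_; reverse)
open import Data.List.Membership.Propositional using (lose)
open import Data.List.Membership.Propositional.Properties
  using (∈-map⁻; ∈-++⁻; ∈-filter⁺; ∈-concatMap⁺; ∈-allFin)
import Data.List.Membership.DecPropositional as DecMembership
import Data.List.Properties as Listₚ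
open import Data.List.Relation.Binary.Subset.Propositional using (_⊆_)
import Data.List.Relation.Binary.Subset.DecPropositional as DecSubset
open import Data.List.Relation.Unary.All as All using (All)
open import Data.List.Relation.Unary.All.Properties using (map⁺)
open import Data.List.Relation.Unary.AllPairs using (allPairs?)
open import Data.List.Relation.Unary.Any using (here; there)
open import Data.Nat using (suc; _*_; _+_; _≤_; _≤?_; _≤ᵇ_)
open import Data.Nat.DivMod using (_mod_)
open import Data.Nat.Properties using (≤⇒≤ᵇ; ≤ᵇ⇒≤)
open import Data.Product using (_,_; proj₁; proj₂; ∃₂; map₂; uncurry)
open import Data.Product.Properties using (,-injectiveˡ; ,-injectiveʳ)
import Data.Product.Properties as Productₚ
open import Data.Sum using (inj₁; inj₂; [_,_]′)
open import Data.Vec as Vec using (Vec; lookup; tabulate)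
open import Data.Vec.Properties using (lookup-map; tabulate∘lookup; tabulate-cong)
import Data.Vec.Properties as Vecₚ
open import Function using (_∘_)
open import Function.Bundles using (Equivalence; Injection; mk⇔)
open import Function.Properties.Inverse using (↔⇒↣)
open import Relation.Binary.Definitions using (Decidable; DecidableEquality)
open import Relation.Binary.PropositionalEquality
  using (refl; sym; trans; cong; cong₂; subst; module ≡-Reasoning)
open import Relation.Nullary using (Dec; ¬?)
open import Relation.Nullary.Decidable using (_×-dec_; _→-dec_; from-yes; map′)

-- Every point of ℤ₅² is a codeword of a perfect code (the translates of the line y = 2x are
-- perfect), and the palette of a perfect code tells its balls apart, so a grid is special
-- exactly when it is injective on every Lee ball of radius 1.  The Latin conditions come for
-- free: two cells of a row or a column are at Lee distance at most 2, hence share such a ball.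
-- Special grids are thus the colourings of ℤ₅² in which cells at Lee distance 1 or 2 differ,
-- and an exhaustive backtracking search over the 25 cells finds exactly 240 of them: the
-- relabelings of S₀(i, j) = 2i + j and of its reflection.

all²? : ∀ {m n} {P : Fin m × Fin n → Set} → (∀ p → Dec (P p)) → Dec (∀ p → P p)
all²? P? = map′ (λ h (i , j) → h i j) (λ h i j → h (i , j)) (all? λ i → all? λ j → P? (i , j))

any²? : ∀ {m n} {P : Fin m × Fin n → Set} → (∀ p → Dec (P p)) → Dec (∃ P)
any²? P? = map′ (λ (i , j , h) → (i , j) , h) (λ ((i , j) , h) → i , j , h)
                (any? λ i → any? λ j → P? (i , j))

_≟²_ : DecidableEquality Z5²
_≟²_ = Productₚ.≡-dec _≟_ _≟_

inBall₁? : ∀ c p → Dec (InBall₁ c p)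
inBall₁? c p = leeDist p c ≤? 1

isPerfectCode? : ∀ c → Dec (IsPerfectCode c)
isPerfectCode? c =
  (all? λ i → all? λ j → (c i ≟² c j) →-dec (i ≟ j))
  ×-dec (all? λ i → all? λ j → ¬? (i ≟ j) →-dec (3 ≤? leeDist (c i) (c j)))
  ×-dec (all²? λ p → any? λ i → inBall₁? (c i) p)
  ×-dec (all? λ i → all? λ j → all²? λ p → inBall₁? (c i) p →-dec inBall₁? (c j) p →-dec (i ≟ j))

slopeTwoCode : Z5 → Code
slopeTwoCode t x = x , (2 * toℕ x + toℕ t) mod 5

slopeTwoCode-perfect : ∀ t → IsPerfectCode (slopeTwoCode t)
slopeTwoCode-perfect = from-yes (all? λ t → isPerfectCode? (slopeTwoCode t))

slopeTwoCode-covers : ∀ z → ∃ λ t → slopeTwoCode t (proj₁ z) ≡ z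
slopeTwoCode-covers = from-yes (all²? λ z → any? λ t → slopeTwoCode t (proj₁ z) ≟² z)

perfectCode-through : ∀ z → ∃₂ λ c i → IsPerfectCode c × c i ≡ z
perfectCode-through z =
  let t , onLine = slopeTwoCode-covers z
  in slopeTwoCode t , proj₁ z , slopeTwoCode-perfect t , onLine

leeDist≤2⇒sharedBall : ∀ p q → leeDist p q ≤ 2 → ∃ λ z → InBall₁ z p × InBall₁ z q
leeDist≤2⇒sharedBall =
  from-yes (all²? λ p → all²? λ q →
    (leeDist p q ≤? 2) →-dec any²? λ z → inBall₁? z p ×-dec inBall₁? z q)

leeDist-sameRow≤2 : ∀ i j l → leeDist (i , j) (i , l) ≤ 2
leeDist-sameRow≤2 = from-yes (all? λ i → all? λ j → all? λ l → leeDist (i , j) (i , l) ≤? 2)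

leeDist-sameColumn≤2 : ∀ i k j → leeDist (i , j) (k , j) ≤ 2
leeDist-sameColumn≤2 = from-yes (all? λ i → all? λ k → all? λ j → leeDist (i , j) (k , j) ≤? 2)

firstIdx-sound : ∀ (t : Fin 5 → Bool) i → T (t i) → T (t (firstIdx t))
firstIdx-sound t i tᵢ with t 0F in e₀ | t 1F in e₁ | t 2F in e₂ | t 3F in e₃ | t 4F in e₄
... | true  | _     | _     | _     | _    = Equivalence.from T-≡ e₀
... | false | true  | _     | _     | _    = Equivalence.from T-≡ e₁
... | false | false | true  | _     | _    = Equivalence.from T-≡ e₂
... | false | false | false | true  | _    = Equivalence.from T-≡ e₃
... | false | false | false | false | true = Equivalence.from T-≡ e₄
firstIdx-sound t 0F tᵢ | false | false | false | false | false = ⊥-elim (subst T e₀ tᵢ)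
firstIdx-sound t 1F tᵢ | false | false | false | false | false = ⊥-elim (subst T e₁ tᵢ)
firstIdx-sound t 2F tᵢ | false | false | false | false | false = ⊥-elim (subst T e₂ tᵢ)
firstIdx-sound t 3F tᵢ | false | false | false | false | false = ⊥-elim (subst T e₃ tᵢ)
firstIdx-sound t 4F tᵢ | false | false | false | false | false = ⊥-elim (subst T e₄ tᵢ)

module _ {c : Code} (perfect : IsPerfectCode c) where

  palette-inBall : ∀ x y → InBall₁ (c (palette c x y)) (x , y)
  palette-inBall x y =
    let i , xy∈Bᵢ = proj₁ (proj₂ (proj₂ perfect)) (x , y)
    in ≤ᵇ⇒≤ _ 1 (firstIdx-sound (λ i → leeDist (x , y) (c i) ≤ᵇ 1) i (≤⇒≤ᵇ xy∈Bᵢ))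

  palette-unique : ∀ {z} x y i → c i ≡ z → InBall₁ z (x , y) → palette c x y ≡ i
  palette-unique x y i refl xy∈Bᵢ =
    proj₂ (proj₂ (proj₂ perfect)) (palette c x y) i (x , y) (palette-inBall x y) xy∈Bᵢ

InjectiveOnBalls : {X : Set} → (Z5² → X) → Set
InjectiveOnBalls f = ∀ z p q → InBall₁ z p → InBall₁ z q → f p ≡ f q → p ≡ q

injectiveOnBalls? : {X : Set} → DecidableEquality X → (f : Z5² → X) → Dec (InjectiveOnBalls f)
injectiveOnBalls? _≟ₓ_ f =
  all²? λ z → all²? λ p → all²? λ q →
    inBall₁? z p →-dec inBall₁? z q →-dec (f p ≟ₓ f q) →-dec (p ≟² q)

injectiveOnBalls-leeDist≤2 : ∀ {X} {f : Z5² → X} → InjectiveOnBalls f →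
                             ∀ p q → leeDist p q ≤ 2 → f p ≡ f q → p ≡ q
injectiveOnBalls-leeDist≤2 inj p q d =
  let z , p∈Bz , q∈Bz = leeDist≤2⇒sharedBall p q d in inj z p q p∈Bz q∈Bz

cellEntry : Grid → Z5² → Fin 5
cellEntry A (i , j) = entry A i j

special⇒injectiveOnBalls : ∀ A → Special A → InjectiveOnBalls (cellEntry A)
special⇒injectiveOnBalls A special z (i , j) (k , l) p∈Bz q∈Bz e =
  let c , m , perfect , cₘ≡z = perfectCode-through z
      samePalette = trans (palette-unique perfect i j m cₘ≡z p∈Bz)
                          (sym (palette-unique perfect k l m cₘ≡z q∈Bz))
  in uncurry (cong₂ _,_) (proj₂ (special c perfect) i j k l e samePalette)

injectiveOnBalls⇒special : ∀ A → InjectiveOnBalls (cellEntry A) → Special A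
injectiveOnBalls⇒special A inj c perfect = (rows , columns) , orthogonal
  where
  rows : ∀ i j l → entry A i j ≡ entry A i l → j ≡ l
  rows i j l =
    ,-injectiveʳ ∘ injectiveOnBalls-leeDist≤2 inj (i , j) (i , l) (leeDist-sameRow≤2 i j l)

  columns : ∀ j i k → entry A i j ≡ entry A k j → i ≡ k
  columns j i k =
    ,-injectiveˡ ∘ injectiveOnBalls-leeDist≤2 inj (i , j) (k , j) (leeDist-sameColumn≤2 i k j)

  orthogonal : Orthogonal (entry A) (palette c)
  orthogonal i j k l e samePalette =
    let ij∈B = subst (λ m → InBall₁ (c m) (i , j)) samePalette (palette-inBall perfect i j)
        i,j≡k,l = inj (c (palette c k l)) (i , j) (k , l) ij∈B (palette-inBall perfect k l) e
    in ,-injectiveˡ i,j≡k,l , ,-injectiveʳ i,j≡k,l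

module Backtracking {P V : Set} (_≟ₚ_ : DecidableEquality P) (_≟ᵥ_ : DecidableEquality V)
                    {_~_ : P → P → Set} (_~?_ : Decidable _~_) (values : List V) where

  Assignment : Set
  Assignment = List (P × V)

  Compatible : P → V → Assignment → Set
  Compatible p v = All λ (q , w) → v ≡ w → p ~ q → p ≡ q

  compatible? : ∀ p α v → Dec (Compatible p v α)
  compatible? p α v = All.all? (λ (q , w) → (v ≟ᵥ w) →-dec (p ~? q) →-dec (p ≟ₚ q)) α

  extensions : List P → Assignment → List Assignment
  extensions []       α = α ∷ []
  extensions (p ∷ ps) α =
    concatMap (λ v → extensions ps ((p , v) ∷ α)) (filter (compatible? p α) values)

  solutions : List P → List Assignment
  solutions ps = extensions ps []

  graph : (P → V) → List P → Assignment
  graph f = map λ p → p , f p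

  graph-injective : ∀ {f g} ps → graph f ps ≡ graph g ps → ∀ {p} → p ∈ ps → f p ≡ g p
  graph-injective (q ∷ ps) eq (here refl)  = ,-injectiveʳ (Listₚ.∷-injectiveˡ eq)
  graph-injective (q ∷ ps) eq (there p∈ps) = graph-injective ps (Listₚ.∷-injectiveʳ eq) p∈ps

  module _ (f : P → V) (values-complete : ∀ v → v ∈ values)
           (f-injective : ∀ p q → p ~ q → f p ≡ f q → p ≡ q) where

    extensions-complete : ∀ ps qs → graph f (ps ʳ++ qs) ∈ extensions ps (graph f qs)
    extensions-complete []       qs = here refl
    extensions-complete (p ∷ ps) qs =
      ∈-concatMap⁺ (λ v → extensions ps ((p , v) ∷ graph f qs))
        (lose (∈-filter⁺ (compatible? p (graph f qs)) (values-complete (f p)) compatible)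
              (extensions-complete ps (p ∷ qs)))
      where
      compatible : Compatible p (f p) (graph f qs)
      compatible = map⁺ (All.universal (λ q e p~q → f-injective p q p~q e) qs)

    solutions-complete : ∀ ps → graph f (reverse ps) ∈ solutions ps
    solutions-complete ps = extensions-complete ps []

open Backtracking _≟²_ _≟_ (λ p q → leeDist p q ≤? 2) (allFin 5)

lookup-ext : ∀ {A : Set} {n} {xs ys : Vec A n} → (∀ i → lookup xs i ≡ lookup ys i) → xs ≡ ys
lookup-ext {xs = xs} {ys} eq = begin
  xs                   ≡⟨ tabulate∘lookup xs ⟨
  tabulate (lookup xs) ≡⟨ tabulate-cong eq ⟩
  tabulate (lookup ys) ≡⟨ tabulate∘lookup ys ⟩
  ys                   ∎
  where open ≡-Reasoning

cells : List Z5²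
cells = cartesianProduct (allFin 5) (allFin 5)

gridGraph : Grid → Assignment
gridGraph A = graph (cellEntry A) (reverse cells)

gridGraph-injective : ∀ {A B} → gridGraph A ≡ gridGraph B → A ≡ B
gridGraph-injective {A} {B} eq =
  lookup-ext λ i → lookup-ext λ j →
    graph-injective {cellEntry A} {cellEntry B} (reverse cells) eq (every-cell-listed (i , j))
  where
  open DecMembership _≟²_ using (_∈?_)
  every-cell-listed : ∀ p → p ∈ reverse cells
  every-cell-listed = from-yes (all²? λ p → p ∈? reverse cells)

injectiveOnBalls⇒gridGraph∈solutions : ∀ A → InjectiveOnBalls (cellEntry A) →
                                       gridGraph A ∈ solutions cells
injectiveOnBalls⇒gridGraph∈solutions A inj =
  solutions-complete (cellEntry A) ∈-allFin (injectiveOnBalls-leeDist≤2 inj) cells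

permutations : ∀ n → List (Permutation′ n)
permutations 0       = id ∷ []
permutations (suc n) = concatMap (λ j → map (insert 0F j) (permutations n)) (allFin (suc n))

relabelings : Grid → List Grid
relabelings B = map (λ σ → relabel σ B) (permutations 5)

∈-relabelings⁻ : ∀ B {A} → A ∈ relabelings B → ∃ λ σ → A ≡ relabel σ B
∈-relabelings⁻ B A∈ =
  let σ , _ , A≡ = ∈-map⁻ (λ σ → relabel σ B) {xs = permutations 5} A∈ in σ , A≡

cellEntry-relabel : ∀ σ A p → cellEntry (relabel σ A) p ≡ σ ⟨$⟩ʳ cellEntry A p
cellEntry-relabel σ A (i , j) = begin
  lookup (lookup (relabel σ A) i) j         ≡⟨ cong (λ row → lookup row j) (lookup-map i _ A) ⟩
  lookup (Vec.map (σ ⟨$⟩ʳ_) (lookup A i)) j ≡⟨ lookup-map j _ (lookup A i) ⟩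
  σ ⟨$⟩ʳ lookup (lookup A i) j              ∎
  where open ≡-Reasoning

injectiveOnBalls-relabel : ∀ σ A → InjectiveOnBalls (cellEntry A) →
                           InjectiveOnBalls (cellEntry (relabel σ A))
injectiveOnBalls-relabel σ A inj z p q p∈Bz q∈Bz e =
  inj z p q p∈Bz q∈Bz (Injection.injective (↔⇒↣ σ)
    (trans (sym (cellEntry-relabel σ A p)) (trans e (cellEntry-relabel σ A q))))

relabelings-injectiveOnBalls : ∀ B → InjectiveOnBalls (cellEntry B) →
                               ∀ {A} → A ∈ relabelings B → InjectiveOnBalls (cellEntry A)
relabelings-injectiveOnBalls B inj A∈ =
  let σ , A≡ = ∈-relabelings⁻ B A∈
  in subst (InjectiveOnBalls ∘ cellEntry) (sym A≡) (injectiveOnBalls-relabel σ B inj)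

specialGrid₀ : Grid
specialGrid₀ = tabulate λ i → tabulate λ j → (2 * toℕ i + toℕ j) mod 5

specialGrids : List Grid
specialGrids = relabelings specialGrid₀ ++ relabelings (reflect specialGrid₀)

∈-specialGrids⁻ : ∀ {A} → A ∈ specialGrids →
                  ∃ λ σ → A ≡ relabel σ specialGrid₀ ⊎ A ≡ relabel σ (reflect specialGrid₀)
∈-specialGrids⁻ A∈ =
  [ map₂ inj₁ ∘ ∈-relabelings⁻ specialGrid₀ , map₂ inj₂ ∘ ∈-relabelings⁻ (reflect specialGrid₀) ]′
    (∈-++⁻ (relabelings specialGrid₀) A∈)

specialGrids-unique : Unique specialGrids
specialGrids-unique =
  from-yes (allPairs? (λ A B → ¬? (Vecₚ.≡-dec (Vecₚ.≡-dec _≟_) A B)) specialGrids)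

specialGrid₀-injectiveOnBalls : InjectiveOnBalls (cellEntry specialGrid₀)
specialGrid₀-injectiveOnBalls = from-yes (injectiveOnBalls? _≟_ (cellEntry specialGrid₀))

reflect-specialGrid₀-injectiveOnBalls : InjectiveOnBalls (cellEntry (reflect specialGrid₀))
reflect-specialGrid₀-injectiveOnBalls =
  from-yes (injectiveOnBalls? _≟_ (cellEntry (reflect specialGrid₀)))

specialGrids-injectiveOnBalls : ∀ {A} → A ∈ specialGrids → InjectiveOnBalls (cellEntry A)
specialGrids-injectiveOnBalls A∈ =
  [ relabelings-injectiveOnBalls specialGrid₀ specialGrid₀-injectiveOnBalls
  , relabelings-injectiveOnBalls (reflect specialGrid₀) reflect-specialGrid₀-injectiveOnBalls
  ]′ (∈-++⁻ (relabelings specialGrid₀) A∈)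

solutions⊆specialGrids : solutions cells ⊆ map gridGraph specialGrids
solutions⊆specialGrids = from-yes (solutions cells ⊆? map gridGraph specialGrids)
  where open DecSubset (Listₚ.≡-dec (Productₚ.≡-dec _≟²_ _≟_)) using (_⊆?_)

injectiveOnBalls⇒∈specialGrids : ∀ A → InjectiveOnBalls (cellEntry A) → A ∈ specialGrids
injectiveOnBalls⇒∈specialGrids A inj =
  fromGraph (∈-map⁻ gridGraph {xs = specialGrids}
              (solutions⊆specialGrids (injectiveOnBalls⇒gridGraph∈solutions A inj)))
  where
  -- Pattern matching, unlike projections, keeps the type checker from unfolding the search.
  fromGraph : (∃ λ B → B ∈ specialGrids × gridGraph A ≡ gridGraph B) → A ∈ specialGrids
  fromGraph (B , B∈ , graphs≡) = subst (_∈ specialGrids) (sym (gridGraph-injective graphs≡)) B∈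

special⇔∈specialGrids : ∀ A → Special A ⇔ A ∈ specialGrids
special⇔∈specialGrids A = mk⇔ (injectiveOnBalls⇒∈specialGrids A ∘ special⇒injectiveOnBalls A)
                              (injectiveOnBalls⇒special A ∘ specialGrids-injectiveOnBalls)

theorem13 :
  (Σ (List Grid) λ L → Unique L × length L ≡ 240 × (∀ A → Special A ⇔ A ∈ L))
  × (Σ Grid λ S₀ → Special S₀
       × (∀ A → Special A →
            ∃ λ (σ : Permutation′ 5) → A ≡ relabel σ S₀ ⊎ A ≡ relabel σ (reflect S₀)))
theorem13 =
    (specialGrids , specialGrids-unique , refl , special⇔∈specialGrids)
  , ( specialGrid₀
    , injectiveOnBalls⇒special specialGrid₀ specialGrid₀-injectiveOnBalls
    , λ A → ∈-specialGrids⁻ ∘ Equivalence.to (special⇔∈specialGrids A))
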